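{- Let $q>p>1$ be relatively prime integers. Then $f_{p,q}(n+1)>f_{p,q}(n)$ for infinitely many positive integers $n$.
   Context: $\mathbb{N}$ denotes the set of nonnegative integers. For relatively prime integers $p,q>1$, $f_{p,q}(n)$ denotes the number of different expressions of the positive integer $n$ as a sum of distinct terms taken from $\{p^{\alpha}q^{\beta}:\alpha,\beta\in\mathbb{N}\}$ (i.e. the number of finite subsets of this set whose elements sum to $n$). -}

module Defs where

open import Data.Nat using (ℕ; zero; suc; _+_; _*_; _^_; _≟_)
open import Data.Bool using (Bool; true; false)
open import Data.List using (List; []; _∷_; map; _++_; filter; length; upTo)
open import Data.Bool.ListAction using (any)
open import Data.Nat.ListAction using (sum)
open import Relation.Nullary.Decidable using (⌊_⌋)

-- Boolean test for m ∈ T(p,q), searching α, β ≤ m.  For p, q ≥ 2 this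
-- search is exhaustive, since p^α ≥ 2^α > α (so α, β ≤ m whenever p^α q^β = m).
isTerm? : ℕ → ℕ → ℕ → Bool
isTerm? p q m = any (λ α → any (λ β → ⌊ p ^ α * q ^ β ≟ m ⌋) (upTo (suc m))) (upTo (suc m))

termsUpTo : ℕ → ℕ → ℕ → List ℕ
termsUpTo p q n = filter (λ m → isTerm? p q m Data.Bool.≟ true) (map suc (upTo n))
  where import Data.Bool

-- All sub-lists (= subsets, since the input list has no repetitions).
sublists : List ℕ → List (List ℕ)
sublists []       = [] ∷ []
sublists (x ∷ xs) = sublists xs ++ map (x ∷_) (sublists xs)

-- f_{p,q}(n): number of finite subsets of T(p,q) whose elements sum to n.
-- Every element of such a subset is ≤ n (and ≥ 1), so it is a subset of termsUpTo p q n.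
f : ℕ → ℕ → ℕ → ℕ
f p q n = length (filter (λ s → sum s ≟ n) (sublists (termsUpTo p q n)))

{-# OPTIONS --safe #-}
-- It suffices that f p q is unbounded: a function ℕ → ℕ that increased only finitely often
-- would be eventually non-increasing, hence bounded.  For a, b < m the m² terms p^a q^b are
-- pairwise distinct by coprimality; their 2^(m²) subsets all have sums below 1 + m² (pq)^m,
-- so some n is represented at least 2^(m²) / (1 + m² (pq)^m) times, which tends to infinity.
module Submission where

open import Defs
open import Data.Nat using (ℕ; _<_; _+_)
open import Data.Nat.Coprimality using (Coprime)
open import Data.Product using (Σ; _×_)

open import Data.Bool using (true; false)
open import Data.Bool.Properties using (T-≡)
open import Data.Empty using (⊥-elim)
open import Data.List using (List; []; _∷_; map; _++_; filter; length; upTo; cartesianProductWith)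
open import Data.List.Membership.Propositional using (_∈_; lose)
open import Data.List.Membership.Propositional.Properties
  using (∈-upTo⁺; ∈-upTo⁻; ∈-map⁺; ∈-filter⁺; ∈-cartesianProductWith⁻)
open import Data.List.Properties using (length-++; length-map; length-upTo; filter-++; filter-accept; filter-reject)
open import Data.List.Relation.Unary.All as All using (All; []; _∷_)
open import Data.List.Relation.Unary.All.Properties using (─⁺; ¬Any⇒All¬)
open import Data.List.Relation.Unary.AllPairs using (_∷_)
open import Data.List.Relation.Unary.Any using (here; there; _─_)
open import Data.List.Relation.Unary.Any.Properties using (any⁺; ¬Any[])
open import Data.List.Relation.Unary.Unique.Propositional using (Unique)
open import Data.List.Relation.Unary.Unique.Propositional.Properties using (cartesianProductWith⁺; upTo⁺)
open import Data.Nat using (suc; zero; _*_; _^_; _≟_; _≤_; _<?_; _∸_; z≤n; s≤s; z<s; NonZero; >-nonZero)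
open import Data.Nat.Coprimality using (coprime-divisor) renaming (sym to coprime-sym)
open import Data.Nat.Divisibility using (_∣_; _∤_; ∣1⇒≡1; ∣-trans; m∣m*n)
open import Data.Nat.ListAction using (sum)
open import Data.Nat.Properties
open import Algebra.Properties.CommutativeSemigroup +-commutativeSemigroup using (interchange; xy∙z≈xz∙y)
open import Algebra.Properties.CommutativeSemigroup *-commutativeSemigroup
  using () renaming (interchange to *-interchange)
open import Data.List.Membership.DecPropositional _≟_ using (_∈?_)
open import Data.Product using (∃; ∃₂; _,_)
open import Data.Sum using (_⊎_; inj₁; inj₂)
open import Function using (Equivalence; _∘_)
open import Relation.Binary.PropositionalEquality
open import Relation.Nullary using (yes; no; does)
open import Relation.Nullary.Decidable using (fromWitness)

nonZero : ∀ {n} → 1 < n → NonZero n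
nonZero 1<n = >-nonZero (<-trans z<s 1<n)

δ : ℕ → ℕ → ℕ
δ c s with c ≟ s
... | yes _ = 1
... | no  _ = 0

δ-refl : ∀ c → δ c c ≡ 1
δ-refl c with c ≟ c
... | yes _  = refl
... | no c≢c = ⊥-elim (c≢c refl)

δ-≢ : ∀ {c s} → c ≢ s → δ c s ≡ 0
δ-≢ {c} {s} c≢s with c ≟ s
... | yes c≡s = ⊥-elim (c≢s c≡s)
... | no  _   = refl

-- Carrying the offset c, rather than subtracting x from s, avoids truncated subtraction.
ways : List ℕ → ℕ → ℕ → ℕ
ways []       c s = δ c s
ways (x ∷ xs) c s = ways xs c s + ways xs (c + x) s

filter-map-∷ : ∀ x (ls : List (List ℕ)) c s →
  length (filter (λ l → c + sum l ≟ s) (map (x ∷_) ls)) ≡ length (filter (λ l → (c + x) + sum l ≟ s) ls)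
filter-map-∷ x []       c s = refl
filter-map-∷ x (l ∷ ls) c s rewrite +-assoc c x (sum l) with does (c + (x + sum l) ≟ s)
... | true  = cong suc (filter-map-∷ x ls c s)
... | false = filter-map-∷ x ls c s

ways-sublists : ∀ xs c s → length (filter (λ l → c + sum l ≟ s) (sublists xs)) ≡ ways xs c s
ways-sublists [] c s with c ≟ s
... | yes c≡s = cong length (filter-accept (λ l → c + sum l ≟ s) (trans (+-identityʳ c) c≡s))
... | no  c≢s = cong length (filter-reject (λ l → c + sum l ≟ s) (c≢s ∘ trans (sym (+-identityʳ c))))
ways-sublists (x ∷ xs) c s = begin
  length (filter P (sublists xs ++ map (x ∷_) (sublists xs)))
    ≡⟨ cong length (filter-++ P (sublists xs) _) ⟩
  length (filter P (sublists xs) ++ filter P (map (x ∷_) (sublists xs)))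
    ≡⟨ length-++ (filter P (sublists xs)) ⟩
  length (filter P (sublists xs)) + length (filter P (map (x ∷_) (sublists xs)))
    ≡⟨ cong₂ _+_ (ways-sublists xs c s) (trans (filter-map-∷ x (sublists xs) c s) (ways-sublists xs (c + x) s)) ⟩
  ways xs c s + ways xs (c + x) s ∎
  where
  open ≡-Reasoning
  P = λ l → c + sum l ≟ s

sumBelow : (ℕ → ℕ) → ℕ → ℕ
sumBelow h zero    = 0
sumBelow h (suc K) = sumBelow h K + h K

sumBelow-+ : ∀ g h K → sumBelow (λ s → g s + h s) K ≡ sumBelow g K + sumBelow h K
sumBelow-+ g h zero    = refl
sumBelow-+ g h (suc K) = trans (cong (_+ (g K + h K)) (sumBelow-+ g h K))
                               (interchange (sumBelow g K) (sumBelow h K) (g K) (h K))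

sumBelow-δ-≤ : ∀ c K → K ≤ c → sumBelow (δ c) K ≡ 0
sumBelow-δ-≤ c zero    _   = refl
sumBelow-δ-≤ c (suc K) K<c = cong₂ _+_ (sumBelow-δ-≤ c K (<⇒≤ K<c)) (δ-≢ (>⇒≢ K<c))

sumBelow-δ-< : ∀ c K → c < K → sumBelow (δ c) K ≡ 1
sumBelow-δ-< c (suc K) (s≤s c≤K) with m≤n⇒m<n∨m≡n c≤K
... | inj₁ c<K  = cong₂ _+_ (sumBelow-δ-< c K c<K) (δ-≢ (<⇒≢ c<K))
... | inj₂ refl = cong₂ _+_ (sumBelow-δ-≤ c c ≤-refl) (δ-refl c)

sumBelow-ways : ∀ xs c K → c + sum xs < K → sumBelow (ways xs c) K ≡ 2 ^ length xs
sumBelow-ways []       c K c+0<K = sumBelow-δ-< c K (subst (_< K) (+-identityʳ c) c+0<K)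
sumBelow-ways (x ∷ xs) c K c+x+xs<K = begin
  sumBelow (λ s → ways xs c s + ways xs (c + x) s) K
    ≡⟨ sumBelow-+ (ways xs c) (ways xs (c + x)) K ⟩
  sumBelow (ways xs c) K + sumBelow (ways xs (c + x)) K
    ≡⟨ cong₂ _+_ (sumBelow-ways xs c K (≤-<-trans (+-monoʳ-≤ c (m≤n+m (sum xs) x)) c+x+xs<K))
                 (sumBelow-ways xs (c + x) K (subst (_< K) (sym (+-assoc c x (sum xs))) c+x+xs<K)) ⟩
  2 ^ length xs + 2 ^ length xs
    ≡⟨ cong (2 ^ length xs +_) (sym (+-identityʳ (2 ^ length xs))) ⟩
  2 ^ length (x ∷ xs) ∎
  where open ≡-Reasoning

ways-overshoot : ∀ xs {c s} → s < c → ways xs c s ≡ 0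
ways-overshoot []       s<c = δ-≢ (>⇒≢ s<c)
ways-overshoot (x ∷ xs) {c} s<c = cong₂ _+_ (ways-overshoot xs s<c) (ways-overshoot xs (≤-trans s<c (m≤m+n c x)))

ways-allOvershoot : ∀ {xs c s} → All (λ x → s < c + x) xs → ways xs c s ≡ δ c s
ways-allOvershoot []                         = refl
ways-allOvershoot {x ∷ xs} (s<c+x ∷ s<c+xs) =
  trans (cong₂ _+_ (ways-allOvershoot s<c+xs) (ways-overshoot xs s<c+x)) (+-identityʳ _)

ways-─ : ∀ {xs y} (y∈xs : y ∈ xs) c s → ways xs c s ≡ ways (xs ─ y∈xs) c s + ways (xs ─ y∈xs) (c + y) s
ways-─ (here refl) c s = refl
ways-─ {x ∷ xs} {y} (there y∈xs) c s = begin
  ways xs c s + ways xs (c + x) s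
    ≡⟨ cong₂ _+_ (ways-─ y∈xs c s) (ways-─ y∈xs (c + x) s) ⟩
  (W c + W (c + y)) + (W (c + x) + W (c + x + y))
    ≡⟨ cong (λ d → (W c + W (c + y)) + (W (c + x) + W d)) (xy∙z≈xz∙y c x y) ⟩
  (W c + W (c + y)) + (W (c + x) + W (c + y + x))
    ≡⟨ interchange (W c) (W (c + y)) (W (c + x)) (W (c + y + x)) ⟩
  (W c + W (c + x)) + (W (c + y) + W (c + y + x)) ∎
  where
  open ≡-Reasoning
  W = λ d → ways (xs ─ y∈xs) d s

Unique-─ : ∀ {xs : List ℕ} {y} → Unique xs → (y∈xs : y ∈ xs) → Unique (xs ─ y∈xs)
Unique-─ (_ ∷ u)    (here refl)  = u
Unique-─ (x≢xs ∷ u) (there y∈xs) = ─⁺ y∈xs x≢xs ∷ Unique-─ u y∈xs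

─-fresh : ∀ {xs : List ℕ} {y} → Unique xs → (y∈xs : y ∈ xs) → All (y ≢_) (xs ─ y∈xs)
─-fresh (y≢xs ∷ _) (here refl)  = y≢xs
─-fresh (x≢xs ∷ u) (there y∈xs) = ≢-sym (All.lookup x≢xs y∈xs) ∷ ─-fresh u y∈xs

All-∈-tail : ∀ {Q : ℕ → Set} {y ys xs} →
  All (y ≢_) xs → All (λ x → Q x → x ∈ y ∷ ys) xs → All (λ x → Q x → x ∈ ys) xs
All-∈-tail y≢xs reach = All.zipWith drop-y (y≢xs , reach)
  where
  drop-y : ∀ {y ys Q x} → y ≢ x × (Q → x ∈ y ∷ ys) → Q → x ∈ ys
  drop-y (y≢x , reach) qx with reach qx
  ... | here x≡y   = ⊥-elim (y≢x (sym x≡y))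
  ... | there x∈ys = x∈ys

ways-mono : ∀ ys {xs} c s → Unique xs → All (λ x → c + x ≤ s → x ∈ ys) xs → ways xs c s ≤ ways ys c s
ways-mono [] c s _ reach =
  ≤-reflexive (ways-allOvershoot (All.map (λ r → ≰⇒> (¬Any[] ∘ r)) reach))
ways-mono (y ∷ ys) {xs} c s u reach with y ∈? xs
... | no y∉xs = ≤-trans (ways-mono ys c s u (All-∈-tail (¬Any⇒All¬ xs y∉xs) reach)) (m≤m+n _ _)
... | yes y∈xs = begin
  ways xs c s                                       ≡⟨ ways-─ y∈xs c s ⟩
  ways (xs ─ y∈xs) c s + ways (xs ─ y∈xs) (c + y) s ≤⟨ +-mono-≤ (ways-mono ys c s u′ reach′)
                                                                 (ways-mono ys (c + y) s u′ reach″) ⟩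
  ways ys c s + ways ys (c + y) s                   ∎
  where
  open ≤-Reasoning
  u′ = Unique-─ u y∈xs
  reach′ = All-∈-tail (─-fresh u y∈xs) (─⁺ y∈xs reach)
  reach″ = All.map (λ r c+y+x≤s → r (≤-trans (+-monoˡ-≤ _ (m≤m+n c y)) c+y+x≤s)) reach′

sumBelow-≤⊎exceeds : ∀ h B K → sumBelow h K ≤ K * B ⊎ ∃ λ s → B < h s
sumBelow-≤⊎exceeds h B zero = inj₁ z≤n
sumBelow-≤⊎exceeds h B (suc K) with sumBelow-≤⊎exceeds h B K | B <? h K
... | inj₂ exceeds | _       = inj₂ exceeds
... | inj₁ _       | yes B<h = inj₂ (K , B<h)
... | inj₁ sum≤    | no  B≮h = inj₁ (subst (sumBelow h K + h K ≤_) (+-comm (K * B) B) (+-mono-≤ sum≤ (≮⇒≥ B≮h)))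

n<m^n : ∀ {m} → 1 < m → ∀ n → n < m ^ n
n<m^n     1<m zero    = z<s
n<m^n {m} 1<m (suc n) = begin-strict
  suc n             <⟨ s≤s (n<m^n 1<m n) ⟩
  suc (m ^ n)       ≤⟨ +-monoˡ-≤ (m ^ n) (m^n>0 m {{nonZero 1<m}} n) ⟩
  m ^ n + m ^ n     ≡⟨ cong (m ^ n +_) (sym (+-identityʳ (m ^ n))) ⟩
  2 * m ^ n         ≤⟨ *-monoˡ-≤ (m ^ n) 1<m ⟩
  m ^ suc n         ∎
  where open ≤-Reasoning

^≤2^* : ∀ r n → r ^ n ≤ 2 ^ (r * n)
^≤2^* r n = ≤-trans (^-monoˡ-≤ n (<⇒≤ (n<m^n ≤-refl r))) (≤-reflexive (^-*-assoc 2 r n))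

-- m = 2 + r + B is chosen so that m * m = (2 + r) * m + B * m, where 2 ^ ((2 + r) * m) bounds
-- m * m * r ^ m and 2 ^ B bounds B.
2^-dominates : ∀ r B → let m = 2 + r + B in suc (m * m * r ^ m) * B < 2 ^ (m * m)
2^-dominates r B = begin-strict
  suc (m * m * r ^ m) * B ≤⟨ *-monoˡ-≤ B grid<2^E ⟩
  2 ^ E * B               <⟨ *-monoʳ-< (2 ^ E) {{m^n≢0 2 E}} (n<m^n ≤-refl B) ⟩
  2 ^ E * 2 ^ B           ≡⟨ ^-distribˡ-+-* 2 E B ⟨
  2 ^ (E + B)             ≤⟨ ^-monoʳ-≤ 2 (+-monoʳ-≤ E (m≤m*n B m)) ⟩
  2 ^ (E + B * m)         ≡⟨ cong (2 ^_) (*-distribʳ-+ m (2 + r) B) ⟨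
  2 ^ (m * m)             ∎
  where
  open ≤-Reasoning
  m = 2 + r + B
  E = (2 + r) * m
  grid<2^E : m * m * r ^ m < 2 ^ E
  grid<2^E = begin-strict
    m * m * r ^ m               ≤⟨ *-monoʳ-≤ (m * m) (^≤2^* r m) ⟩
    m * m * 2 ^ (r * m)         <⟨ *-monoˡ-< (2 ^ (r * m)) {{m^n≢0 2 (r * m)}} (*-mono-< (n<m^n ≤-refl m) (n<m^n ≤-refl m)) ⟩
    2 ^ m * 2 ^ m * 2 ^ (r * m) ≡⟨ *-assoc (2 ^ m) (2 ^ m) (2 ^ (r * m)) ⟩
    2 ^ m * (2 ^ m * 2 ^ (r * m)) ≡⟨ cong (2 ^ m *_) (^-distribˡ-+-* 2 m (r * m)) ⟨
    2 ^ m * 2 ^ (m + r * m)     ≡⟨ ^-distribˡ-+-* 2 m (m + r * m) ⟨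
    2 ^ E                       ∎

^-distribʳ-* : ∀ m n o → (m * n) ^ o ≡ m ^ o * n ^ o
^-distribʳ-* m n zero    = refl
^-distribʳ-* m n (suc o) = trans (cong (m * n *_) (^-distribʳ-* m n o)) (*-interchange m n (m ^ o) (n ^ o))

length-cartesianProductWith : ∀ {A B C : Set} (f : A → B → C) xs ys →
  length (cartesianProductWith f xs ys) ≡ length xs * length ys
length-cartesianProductWith f []       ys = refl
length-cartesianProductWith f (x ∷ xs) ys = begin
  length (map (f x) ys ++ cartesianProductWith f xs ys)          ≡⟨ length-++ (map (f x) ys) ⟩
  length (map (f x) ys) + length (cartesianProductWith f xs ys)  ≡⟨ cong₂ _+_ (length-map (f x) ys)
                                                                       (length-cartesianProductWith f xs ys) ⟩
  length ys + length xs * length ys                              ∎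
  where open ≡-Reasoning

sum≤length* : ∀ {xs M} → All (_≤ M) xs → sum xs ≤ length xs * M
sum≤length* []            = z≤n
sum≤length* (x≤M ∷ xs≤M) = +-mono-≤ x≤M (sum≤length* xs≤M)

stepIncrease : ∀ (h : ℕ → ℕ) a d → h a < h (a + d) → ∃ λ n → a ≤ n × h n < h (suc n)
stepIncrease h a zero    ha<ha+0 = ⊥-elim (<-irrefl (cong h (sym (+-identityʳ a))) ha<ha+0)
stepIncrease h a (suc d) ha<     with h (a + d) <? h (suc (a + d))
... | yes step = a + d , m≤m+n a d , step
... | no  ¬step = stepIncrease h a d (<-≤-trans ha< (≤-trans (≤-reflexive (cong h (+-suc a d))) (≮⇒≥ ¬step)))

h≤sumBelow : ∀ (h : ℕ → ℕ) {i} K → i < K → h i ≤ sumBelow h K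
h≤sumBelow h (suc K) (s≤s i≤K) with m≤n⇒m<n∨m≡n i≤K
... | inj₁ i<K  = ≤-trans (h≤sumBelow h K i<K) (m≤m+n _ _)
... | inj₂ refl = m≤n+m _ _

increasesAfter : ∀ (h : ℕ → ℕ) N s → sumBelow h (2 + N) < h s → ∃ λ n → N < n × h n < h (suc n)
increasesAfter h N s prefix<hs = stepIncrease h (suc N) (s ∸ suc N) hN+1<hs
  where
  N+1<s : suc N < s
  N+1<s = ≰⇒> λ s≤N+1 → <⇒≱ prefix<hs (h≤sumBelow h (2 + N) (s≤s s≤N+1))
  hN+1<hs : h (suc N) < h (suc N + (s ∸ suc N))
  hN+1<hs = <-≤-trans (≤-<-trans (h≤sumBelow h (2 + N) ≤-refl) prefix<hs)
                      (≤-reflexive (cong h (sym (m+[n∸m]≡n (<⇒≤ N+1<s)))))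

unbounded⇒increasesInfinitelyOften : ∀ (h : ℕ → ℕ) → (∀ B → ∃ λ s → B < h s) →
  ∀ N → ∃ λ n → N < n × h n < h (n + 1)
unbounded⇒increasesInfinitelyOften h unbounded N with unbounded (sumBelow h (2 + N))
... | s , prefix<hs with increasesAfter h N s prefix<hs
...   | n , N<n , step = n , N<n , subst (λ t → h n < h t) (+-comm 1 n) step

IsTerm : ℕ → ℕ → ℕ → Set
IsTerm p q x = ∃₂ λ a b → p ^ a * q ^ b ≡ x

p∤q^n : ∀ {p q} → Coprime p q → 1 < p → ∀ n → p ∤ q ^ n
p∤q^n cop 1<p zero    p∣1    = <⇒≢ 1<p (sym (∣1⇒≡1 p∣1))
p∤q^n cop 1<p (suc n) p∣q*qⁿ = p∤q^n cop 1<p n (coprime-divisor cop p∣q*qⁿ)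

exponentˡ-unique : ∀ {p q} → Coprime p q → 1 < p →
  ∀ a b c d → p ^ a * q ^ b ≡ p ^ c * q ^ d → a ≡ c
exponentˡ-unique cop 1<p zero    b zero    d _ = refl
exponentˡ-unique {p} {q} cop 1<p zero b (suc c) d qᵇ≡ =
  ⊥-elim (p∤q^n cop 1<p b (subst (p ∣_) (trans (sym qᵇ≡) (*-identityˡ (q ^ b))) (∣-trans (m∣m*n (p ^ c)) (m∣m*n (q ^ d)))))
exponentˡ-unique cop 1<p (suc a) b zero    d eq = sym (exponentˡ-unique cop 1<p zero d (suc a) b (sym eq))
exponentˡ-unique {p} {q} cop 1<p (suc a) b (suc c) d eq =
  cong suc (exponentˡ-unique cop 1<p a b c d (*-cancelˡ-≡ _ _ p {{nonZero 1<p}}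
    (trans (sym (*-assoc p (p ^ a) (q ^ b))) (trans eq (*-assoc p (p ^ c) (q ^ d))))))

exponents-unique : ∀ {p q} → Coprime p q → 1 < p → 1 < q →
  ∀ {a b c d} → p ^ a * q ^ b ≡ p ^ c * q ^ d → a ≡ c × b ≡ d
exponents-unique {p} {q} cop 1<p 1<q {a} {b} {c} {d} eq =
  exponentˡ-unique cop 1<p a b c d eq ,
  exponentˡ-unique (coprime-sym cop) 1<q b a d c (trans (*-comm (q ^ b) (p ^ a)) (trans eq (*-comm (p ^ c) (q ^ d))))

module _ {p q : ℕ} (1<p : 1 < p) (1<q : 1 < q) where

  private instance
    p≢0 : NonZero p
    p≢0 = nonZero 1<p
    q≢0 : NonZero q
    q≢0 = nonZero 1<q

  isTerm?-complete : ∀ a b → isTerm? p q (p ^ a * q ^ b) ≡ true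
  isTerm?-complete a b = Equivalence.to T-≡
    (any⁺ _ (lose (∈-upTo⁺ (s≤s a≤x)) (any⁺ _ (lose (∈-upTo⁺ (s≤s b≤x)) (fromWitness refl)))))
    where
    a≤x : a ≤ p ^ a * q ^ b
    a≤x = ≤-trans (<⇒≤ (n<m^n 1<p a)) (m≤m*n (p ^ a) (q ^ b) {{m^n≢0 q b}})
    b≤x : b ≤ p ^ a * q ^ b
    b≤x = ≤-trans (<⇒≤ (n<m^n 1<q b)) (m≤n*m (q ^ b) (p ^ a) {{m^n≢0 p a}})

  term∈termsUpTo : ∀ {x s} → IsTerm p q x → x ≤ s → x ∈ termsUpTo p q s
  term∈termsUpTo (a , b , refl) x≤s =
    ∈-filter⁺ _ (∈-map-suc-upTo (*-mono-≤ (m^n>0 p a) (m^n>0 q b)) x≤s) (isTerm?-complete a b)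
    where
    ∈-map-suc-upTo : ∀ {x s} → 0 < x → x ≤ s → x ∈ map suc (upTo s)
    ∈-map-suc-upTo {suc y} _ y<s = ∈-map⁺ suc (∈-upTo⁺ y<s)

  ways≤f : ∀ {xs s} → Unique xs → All (IsTerm p q) xs → ways xs 0 s ≤ f p q s
  ways≤f {s = s} u terms = ≤-trans
    (ways-mono (termsUpTo p q s) 0 s u (All.map term∈termsUpTo terms))
    (≤-reflexive (sym (ways-sublists (termsUpTo p q s) 0 s)))

  f-exceeds : ∀ {xs} → Unique xs → All (IsTerm p q) xs →
    ∀ B → suc (sum xs) * B < 2 ^ length xs → ∃ λ s → B < f p q s
  f-exceeds {xs} u terms B small with sumBelow-≤⊎exceeds (ways xs 0) B (suc (sum xs))
  ... | inj₂ (s , B<ways) = s , <-≤-trans B<ways (ways≤f u terms)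
  ... | inj₁ total≤       = ⊥-elim (<-irrefl (sumBelow-ways xs 0 (suc (sum xs)) ≤-refl) (≤-<-trans total≤ small))

  grid : ℕ → List ℕ
  grid m = cartesianProductWith (λ a b → p ^ a * q ^ b) (upTo m) (upTo m)

  grid-unique : Coprime p q → ∀ m → Unique (grid m)
  grid-unique cop m = cartesianProductWith⁺ _ (exponents-unique cop 1<p 1<q) (upTo⁺ m) (upTo⁺ m)

  grid-terms : ∀ m → All (IsTerm p q) (grid m)
  grid-terms m = All.tabulate λ x∈grid →
    let a , b , _ , _ , x≡ = ∈-cartesianProductWith⁻ _ (upTo m) (upTo m) x∈grid in a , b , sym x≡

  grid-length : ∀ m → length (grid m) ≡ m * m
  grid-length m = trans (length-cartesianProductWith _ (upTo m) (upTo m)) (cong₂ _*_ (length-upTo m) (length-upTo m))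

  sum-grid≤ : ∀ m → sum (grid m) ≤ m * m * (p * q) ^ m
  sum-grid≤ m = subst (λ n → sum (grid m) ≤ n * (p * q) ^ m) (grid-length m) (sum≤length* (All.tabulate bounded))
    where
    bounded : ∀ {x} → x ∈ grid m → x ≤ (p * q) ^ m
    bounded x∈grid with ∈-cartesianProductWith⁻ _ (upTo m) (upTo m) x∈grid
    ... | a , b , a∈ , b∈ , refl = ≤-trans
      (*-mono-≤ (^-monoʳ-≤ p (<⇒≤ (∈-upTo⁻ a∈))) (^-monoʳ-≤ q (<⇒≤ (∈-upTo⁻ b∈))))
      (≤-reflexive (sym (^-distribʳ-* p q m)))

  f-unbounded : Coprime p q → ∀ B → ∃ λ s → B < f p q s
  f-unbounded cop B = f-exceeds (grid-unique cop m) (grid-terms m) B (begin-strict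
    suc (sum (grid m)) * B        ≤⟨ *-monoˡ-≤ B (s≤s (sum-grid≤ m)) ⟩
    suc (m * m * (p * q) ^ m) * B <⟨ 2^-dominates (p * q) B ⟩
    2 ^ (m * m)                   ≡⟨ cong (2 ^_) (grid-length m) ⟨
    2 ^ length (grid m)           ∎)
    where
    open ≤-Reasoning
    m = 2 + p * q + B

corollary3 : (p q : ℕ) → 1 < p → p < q → Coprime p q →
    (N : ℕ) → Σ ℕ (λ n → N < n × f p q n < f p q (n + 1))
corollary3 p q 1<p p<q cop =
  unbounded⇒increasesInfinitelyOften (f p q) (f-unbounded 1<p (<-trans 1<p p<q) cop)
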